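{- Let $U\le G$, $k\in\{1,\dots,n-1\}$, and let $C$ be a decisive social preference correspondence. If $C$ admits a resolute $U$-symmetric refinement, then the induced $k$-multiwinner social choice correspondence $C_k$ admits a $U$-consistent resolute refinement.
   Context: Let $n,h\ge 2$ be integers, $N=\{1,\dots,n\}$. $S_m$ is the symmetric group on $\{1,\dots,m\}$ with product $(\sigma\tau)(x)=\sigma(\tau(x))$. $\mathbf L(N)$ is the set of linear orders on $N$; a linear order $q$ with $q(1)\succ\dots\succ q(n)$ is identified with the permutation $r\mapsto q(r)$ in $S_n$. Let $\rho_0(r)=n-r+1$, $\Omega=\{id,\rho_0\}\le S_n$. $\mathcal P=\mathbf L(N)^h$. $G=S_h\times S_n\times\Omega$; $p^{(\varphi,\psi,\rho)}$ is the profile with $i$-th component $\psi p_{\varphi^{ -1}(i)}\rho$. A social preference correspondence (SPC) assigns to each $p$ a subset $C(p)\subseteq\mathbf L(N)$; it is $U$-symmetric if $C(p^{(\varphi,\psi,\rho)})=\{\psi q\rho:q\in C(p)\}$ for all $p$ and $(\varphi,\psi,\rho)\in U$. A $k$-multiwinner social choice correspondence assigns to each $p$ a set $C(p)$ of $k$-subsets of $N$; it is $U$-consistent if for all $p$ and $(\varphi,\psi,\rho)\in U$: $C(p^{(\varphi,\psi,\rho)})=\psi C(p)$ if $\rho=id$, and $C(p^{(\varphi,\psi,\rho)})\ne\psi C(p)$ if $\rho=\rho_0$ and $|C(p)|=1$, where $\psi\mathbb W=\{\psi(W):W\in\mathbb W\}$. Decisive: $C(p)\ne\emptyset$ always; resolute: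 $|C(p)|=1$ always; $C'$ refines $C$ if $C'(p)\subseteq C(p)$ for all $p$. The induced $k$-SCC is $C_k(p)=\{\{q(1),\dots,q(k)\}:q\in C(p)\}$. -}

module Defs where

open import Data.Nat using (ℕ; _<ᵇ_)
open import Data.Bool using (Bool; true; false; _xor_)
open import Data.Fin using (Fin; toℕ)
open import Data.Fin.Permutation as P using (Permutation′; _⟨$⟩ʳ_; _⟨$⟩ˡ_; _∘ₚ_; flip; reverse)
open import Data.Fin.Subset using (Subset)
open import Data.Vec using (tabulate; lookup)
open import Data.Product using (Σ; ∃; _×_; _,_)
open import Relation.Binary.PropositionalEquality using (_≡_)
open import Relation.Nullary using (¬_)
open import Function.Bundles using (_⇔_)

-- Permutations (S_m), with the paper's product (σ τ)(x) = σ (τ x).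
-- Permutations are records of functions; they are compared by the
-- pointwise equality P._≈_ (there is no function extensionality).

Perm : ℕ → Set
Perm m = Permutation′ m

infixl 7 _·_
_·_ : ∀ {m} → Perm m → Perm m → Perm m
σ · τ = τ ∘ₚ σ          -- (σ · τ) ⟨$⟩ʳ x ≡ σ ⟨$⟩ʳ (τ ⟨$⟩ʳ x)

idP : ∀ {m} → Perm m
idP = P.id

invP : ∀ {m} → Perm m → Perm m
invP = flip

-- Linear orders on N = Fin n (alternative 1..n is 0..n-1 here).
-- A linear order q is the permutation r ↦ q(r): q(0) is the top
-- alternative, q(n-1) the bottom one.

LO : ℕ → Set
LO n = Perm n

_≈L_ : ∀ {n} → LO n → LO n → Set
q ≈L q' = q P.≈ q'

-- ρ₀(r) = n - r + 1  (0-indexed: r ↦ n - 1 - r)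
ρ₀ : ∀ {n} → Perm n
ρ₀ = reverse

-- Ω = {id, ρ₀}, encoded by Bool: false ↦ id, true ↦ ρ₀.
Ω→Perm : ∀ {n} → Bool → Perm n
Ω→Perm false = idP
Ω→Perm true  = ρ₀

Profile : ℕ → ℕ → Set
Profile h n = Fin h → LO n

_≈Pr_ : ∀ {h n} → Profile h n → Profile h n → Set
p ≈Pr p' = ∀ i → p i ≈L p' i

record G (h n : ℕ) : Set where
  constructor ⟨_,_,_⟩
  field
    φ : Perm h
    ψ : Perm n
    ρ : Bool
open G public

_≈G_ : ∀ {h n} → G h n → G h n → Set
g ≈G g' = (φ g P.≈ φ g') × (ψ g P.≈ ψ g') × (ρ g ≡ ρ g')

eG : ∀ {h n} → G h n
eG = ⟨ idP , idP , false ⟩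

_·G_ : ∀ {h n} → G h n → G h n → G h n
g ·G g' = ⟨ φ g · φ g' , ψ g · ψ g' , ρ g xor ρ g' ⟩

invG : ∀ {h n} → G h n → G h n
invG g = ⟨ invP (φ g) , invP (ψ g) , ρ g ⟩

record IsSubgroup {h n : ℕ} (U : G h n → Set) : Set where
  field
    resp : ∀ {g g'} → g ≈G g' → U g → U g'
    unit : U eG
    mul  : ∀ {g g'} → U g → U g' → U (g ·G g')
    inv  : ∀ {g} → U g → U (invG g)

act : ∀ {h n} → G h n → Profile h n → Profile h n
act g p i = ψ g · p (φ g ⟨$⟩ˡ i) · Ω→Perm (ρ g)

-- Social preference correspondences: C p q means q ∈ C(p).
-- As a function on 𝒫 into subsets of L(N), it must be well defined
-- w.r.t. the (pointwise) equality of profiles and of orders.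

SPC : ℕ → ℕ → Set₁
SPC h n = Profile h n → LO n → Set

WellDefinedSPC : ∀ {h n} → SPC h n → Set
WellDefinedSPC C = ∀ {p p' q q'} → p ≈Pr p' → q ≈L q' → C p q → C p' q'

DecisiveSPC : ∀ {h n} → SPC h n → Set
DecisiveSPC C = ∀ p → ∃ λ q → C p q

ResoluteSPC : ∀ {h n} → SPC h n → Set
ResoluteSPC C = ∀ p → ∃ λ q → C p q × (∀ q' → C p q' → q' ≈L q)

RefinesSPC : ∀ {h n} → SPC h n → SPC h n → Set
RefinesSPC C' C = ∀ p q → C' p q → C p q

Symmetric : ∀ {h n} → (G h n → Set) → SPC h n → Set
Symmetric U C = ∀ p g → U g → ∀ q' →
  C (act g p) q' ⇔ (∃ λ q → C p q × (q' ≈L (ψ g · q · Ω→Perm (ρ g))))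

-- Multiwinner social choice correspondences: D p W means W ∈ D(p),
-- where W ranges over subsets of N (Data.Fin.Subset).

MWSCC : ℕ → ℕ → Set₁
MWSCC h n = Profile h n → Subset n → Set

IsKMultiwinner : ∀ {h n} → ℕ → MWSCC h n → Set
IsKMultiwinner k D = ∀ p W → D p W → Data.Fin.Subset.∣ W ∣ ≡ k

WellDefinedMW : ∀ {h n} → MWSCC h n → Set
WellDefinedMW D = ∀ {p p' W} → p ≈Pr p' → D p W → D p' W

SameSets : ∀ {n} → (Subset n → Set) → (Subset n → Set) → Set
SameSets A B = ∀ W → A W ⇔ B W

-- ψ(W) = { ψ x : x ∈ W }
imageSub : ∀ {n} → Perm n → Subset n → Subset n
imageSub ψ W = tabulate (λ y → lookup W (ψ ⟨$⟩ˡ y))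

imageSet : ∀ {n} → Perm n → (Subset n → Set) → (Subset n → Set)
imageSet ψ 𝕎 W = ∃ λ W' → 𝕎 W' × (W ≡ imageSub ψ W')

Singleton : ∀ {n} → (Subset n → Set) → Set
Singleton 𝕎 = ∃ λ W → ∀ W' → 𝕎 W' ⇔ (W' ≡ W)

DecisiveMW : ∀ {h n} → MWSCC h n → Set
DecisiveMW D = ∀ p → ∃ λ W → D p W

ResoluteMW : ∀ {h n} → MWSCC h n → Set
ResoluteMW D = ∀ p → Singleton (D p)

RefinesMW : ∀ {h n} → MWSCC h n → MWSCC h n → Set
RefinesMW D' D = ∀ p W → D' p W → D p W

Consistent : ∀ {h n} → (G h n → Set) → MWSCC h n → Set
Consistent U D = ∀ p g → U g →
  (ρ g ≡ false → SameSets (D (act g p)) (imageSet (ψ g) (D p))) ×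
  (ρ g ≡ true → Singleton (D p) →
     ¬ SameSets (D (act g p)) (imageSet (ψ g) (D p)))

-- top k q = { q(r) : r < k }  (0-indexed positions); x ∈ top k q iff
-- the position q⁻¹(x) of x is < k.
top : ∀ {n} → ℕ → LO n → Subset n
top k q = tabulate (λ x → toℕ (q ⟨$⟩ˡ x) <ᵇ k)

induced : ∀ {h n} → ℕ → SPC h n → MWSCC h n
induced k C p W = ∃ λ q → C p q × (W ≡ top k q)

module Submission where

-- Let C' be the resolute U-symmetric refinement of C.  The
-- multiwinner correspondence we take is simply the k-SCC induced by C',
--   D = induced k C',   D(p) = { top k q : q ∈ C'(p) },
-- where top k q = {q(1),…,q(k)} is the set of the k best alternatives.
-- Everything reduces to three facts about top k:
--   * it has exactly k elements (k ≤ n);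
--   * it commutes with relabelling:  top k (ψ q) = ψ (top k q);
--   * it is destroyed by reversal:   top k (ψ q ρ₀) ≠ ψ (top k q) when
--     1 ≤ k < n, since the q-best alternative is in the right-hand side
--     but is ranked last (position n > k) by ψ q ρ₀.

open import Defs
open import Data.Nat using (ℕ; zero; suc; _≤_; _<_; _<ᵇ_; z≤n; s≤s)
open import Data.Nat.Properties
  using (+-0-commutativeMonoid; <ᵇ⇒<; <⇒<ᵇ; <⇒≱; ≤-trans; n≤1+n)
open import Data.Product using (∃; _×_; _,_; proj₁; proj₂)
open import Data.Bool using (Bool; true; false)
open import Data.Bool.Properties using (T-≡)
open import Data.Fin using (Fin; toℕ; opposite) renaming (zero to fzero; suc to fsuc)
open import Data.Fin.Properties using (opposite-prop)
open import Data.Fin.Subset using (∣_∣)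
open import Data.Fin.Permutation using (_⟨$⟩ʳ_; _⟨$⟩ˡ_; inverseˡ; inverseʳ)
open import Data.Vec using (tabulate; lookup)
open import Data.Vec.Properties using (lookup∘tabulate; tabulate-cong)
open import Relation.Binary.PropositionalEquality
open import Relation.Nullary using (¬_)
open import Function.Bundles using (mk⇔; Equivalence)
open import Algebra.Properties.CommutativeMonoid.Sum +-0-commutativeMonoid
  using (sum; sum-permute; sum-cong-≗)

indicator : Bool → ℕ
indicator true  = 1
indicator false = 0

∣tabulate∣≡sum : ∀ {n} (f : Fin n → Bool) → ∣ tabulate f ∣ ≡ sum (λ x → indicator (f x))
∣tabulate∣≡sum {zero}  f = refl
∣tabulate∣≡sum {suc n} f with f fzero
... | true  = cong suc (∣tabulate∣≡sum (λ x → f (fsuc x)))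
... | false = ∣tabulate∣≡sum (λ x → f (fsuc x))

count-below : ∀ n k → k ≤ n → sum {n} (λ r → indicator (toℕ r <ᵇ k)) ≡ k
count-below zero    zero    _         = refl
count-below (suc n) zero    _         = count-below n zero z≤n
count-below (suc n) (suc k) (s≤s k≤n) = cong suc (count-below n k k≤n)

≈⇒inverse-≡ : ∀ {n} {q q' : LO n} → q ≈L q' → ∀ x → q ⟨$⟩ˡ x ≡ q' ⟨$⟩ˡ x
≈⇒inverse-≡ {q = q} {q'} q≈q' x = begin
  q ⟨$⟩ˡ x                      ≡⟨ inverseˡ q' ⟨
  q' ⟨$⟩ˡ (q' ⟨$⟩ʳ (q ⟨$⟩ˡ x))  ≡⟨ cong (q' ⟨$⟩ˡ_) (q≈q' _) ⟨
  q' ⟨$⟩ˡ (q ⟨$⟩ʳ (q ⟨$⟩ˡ x))   ≡⟨ cong (q' ⟨$⟩ˡ_) (inverseʳ q) ⟩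
  q' ⟨$⟩ˡ x                     ∎
  where open ≡-Reasoning

top-resp : ∀ {n} k (q q' : LO n) → q ≈L q' → top k q ≡ top k q'
top-resp k q q' q≈q' = tabulate-cong (λ x → cong (λ r → toℕ r <ᵇ k) (≈⇒inverse-≡ {q = q} {q'} q≈q' x))

-- |top k q| = k: reindexing the count by q turns it into a count of positions.
top-card : ∀ {n} k → k ≤ n → (q : LO n) → ∣ top k q ∣ ≡ k
top-card {n} k k≤n q = begin
  ∣ top k q ∣                                              ≡⟨ ∣tabulate∣≡sum (λ x → toℕ (q ⟨$⟩ˡ x) <ᵇ k) ⟩
  sum {n} (λ x → indicator (toℕ (q ⟨$⟩ˡ x) <ᵇ k))          ≡⟨ sum-permute (λ x → indicator (toℕ (q ⟨$⟩ˡ x) <ᵇ k)) q ⟩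
  sum {n} (λ r → indicator (toℕ (q ⟨$⟩ˡ (q ⟨$⟩ʳ r)) <ᵇ k)) ≡⟨ sum-cong-≗ (λ r → cong (λ t → indicator (toℕ t <ᵇ k)) (inverseˡ q {r})) ⟩
  sum {n} (λ r → indicator (toℕ r <ᵇ k))                   ≡⟨ count-below n k k≤n ⟩
  k                                                        ∎
  where open ≡-Reasoning

top-relabel : ∀ {n} k (ψ q : LO n) → top k (ψ · q · idP) ≡ imageSub ψ (top k q)
top-relabel k ψ q = tabulate-cong (λ y → sym (lookup∘tabulate (λ x → toℕ (q ⟨$⟩ˡ x) <ᵇ k) (ψ ⟨$⟩ˡ y)))

-- Reversal changes the top-k set (1 ≤ k < n): y = ψ(q(1)) lies in
-- ψ (top k q), but it is ranked last by ψ q ρ₀, hence not in its top k.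
top-reverse : ∀ {n} k → 1 ≤ k → k < n → (ψ q : LO n) →
  top k (ψ · q · ρ₀) ≢ imageSub ψ (top k q)
top-reverse {suc n} k 1≤k (s≤s k≤n) ψ q top-eq = <⇒≱ last-in-top k≤n
  where
  y : Fin (suc n)
  y = ψ ⟨$⟩ʳ (q ⟨$⟩ʳ fzero)

  y-is-q-best : q ⟨$⟩ˡ (ψ ⟨$⟩ˡ y) ≡ fzero
  y-is-q-best = trans (cong (q ⟨$⟩ˡ_) (inverseˡ ψ)) (inverseˡ q)

  y∈image : lookup (imageSub ψ (top k q)) y ≡ true
  y∈image = begin
    lookup (imageSub ψ (top k q)) y        ≡⟨ lookup∘tabulate (λ z → lookup (top k q) (ψ ⟨$⟩ˡ z)) y ⟩
    lookup (top k q) (ψ ⟨$⟩ˡ y)            ≡⟨ lookup∘tabulate (λ x → toℕ (q ⟨$⟩ˡ x) <ᵇ k) (ψ ⟨$⟩ˡ y) ⟩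
    toℕ (q ⟨$⟩ˡ (ψ ⟨$⟩ˡ y)) <ᵇ k           ≡⟨ cong (λ r → toℕ r <ᵇ k) y-is-q-best ⟩
    0 <ᵇ k                                 ≡⟨ Equivalence.to T-≡ (<⇒<ᵇ 1≤k) ⟩
    true                                   ∎
    where open ≡-Reasoning

  y-ranked-last : lookup (top k (ψ · q · ρ₀)) y ≡ (n <ᵇ k)
  y-ranked-last = begin
    lookup (top k (ψ · q · ρ₀)) y          ≡⟨ lookup∘tabulate (λ x → toℕ ((ψ · q · ρ₀) ⟨$⟩ˡ x) <ᵇ k) y ⟩
    toℕ (opposite (q ⟨$⟩ˡ (ψ ⟨$⟩ˡ y))) <ᵇ k ≡⟨ cong (λ r → toℕ (opposite r) <ᵇ k) y-is-q-best ⟩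
    toℕ (opposite {suc n} fzero) <ᵇ k      ≡⟨ cong (_<ᵇ k) (opposite-prop fzero) ⟩
    n <ᵇ k                                 ∎
    where open ≡-Reasoning

  last-in-top : n < k
  last-in-top = <ᵇ⇒< n k (Equivalence.from T-≡ (begin
    n <ᵇ k                          ≡⟨ y-ranked-last ⟨
    lookup (top k (ψ · q · ρ₀)) y   ≡⟨ cong (λ W → lookup W y) top-eq ⟩
    lookup (imageSub ψ (top k q)) y ≡⟨ y∈image ⟩
    true                            ∎))
    where open ≡-Reasoning

induced-wellDefined : ∀ {h n} k {C : SPC h n} → WellDefinedSPC C → WellDefinedMW (induced k C)
induced-wellDefined k wd p≈p' (q , q∈C , W≡top) = q , wd p≈p' (λ _ → refl) q∈C , W≡top

induced-kMultiwinner : ∀ {h n} k → k ≤ n → (C : SPC h n) → IsKMultiwinner k (induced k C)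
induced-kMultiwinner k k≤n C p W (q , _ , W≡top) = trans (cong ∣_∣ W≡top) (top-card k k≤n q)

induced-resolute : ∀ {h n} k {C : SPC h n} → ResoluteSPC C → ResoluteMW (induced k C)
induced-resolute k res p with res p
... | q₀ , q₀∈C , unique =
  top k q₀ , λ W → mk⇔ (λ { (q , q∈C , W≡top) → trans W≡top (top-resp k q q₀ (unique q q∈C)) })
                       (λ W≡top → q₀ , q₀∈C , W≡top)

induced-refines : ∀ {h n} k {C' C : SPC h n} → RefinesSPC C' C →
  RefinesMW (induced k C') (induced k C)
induced-refines k ref p W (q , q∈C' , W≡top) = q , ref p q q∈C' , W≡top

induced-equivariant : ∀ {h n} k {U : G h n → Set} {C : SPC h n} → Symmetric U C →
  ∀ p φ ψ → U ⟨ φ , ψ , false ⟩ →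
  SameSets (induced k C (act ⟨ φ , ψ , false ⟩ p)) (imageSet ψ (induced k C p))
induced-equivariant k {C = C} sym-C p φ ψ Ug W = mk⇔ forward backward
  where
  g = ⟨ φ , ψ , false ⟩

  forward : induced k C (act g p) W → imageSet ψ (induced k C p) W
  forward (q' , q'∈C , W≡top) with Equivalence.to (sym-C p g Ug q') q'∈C
  ... | q , q∈C , q'≈ψq =
    top k q , (q , q∈C , refl) , trans W≡top (trans (top-resp k q' (ψ · q · idP) q'≈ψq) (top-relabel k ψ q))

  backward : imageSet ψ (induced k C p) W → induced k C (act g p) W
  backward (W' , (q , q∈C , W'≡top) , W≡ψW') =
    ψ · q · idP , Equivalence.from (sym-C p g Ug (ψ · q · idP)) (q , q∈C , λ _ → refl) ,
    trans W≡ψW' (trans (cong (imageSub ψ) W'≡top) (sym (top-relabel k ψ q)))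

-- For ρ = ρ₀ and |D(p)| = 1, say D(p) = {W}, pick q ∈ C(p); then
-- ψ q ρ₀ ∈ C(p^g), and D(p^g) = ψ D(p) would force
-- top k (ψ q ρ₀) = ψ W = ψ (top k q), contradicting top-reverse.
induced-reversal : ∀ {h n} k → 1 ≤ k → k < n → {U : G h n → Set} {C : SPC h n} →
  DecisiveSPC C → Symmetric U C →
  ∀ p φ ψ → U ⟨ φ , ψ , true ⟩ → Singleton (induced k C p) →
  ¬ SameSets (induced k C (act ⟨ φ , ψ , true ⟩ p)) (imageSet ψ (induced k C p))
induced-reversal k 1≤k k<n {C = C} dec sym-C p φ ψ Ug (W , only-W) same
  with dec p
... | q , q∈C
  with Equivalence.to (same (top k (ψ · q · ρ₀)))
         (ψ · q · ρ₀ , Equivalence.from (sym-C p ⟨ φ , ψ , true ⟩ Ug _) (q , q∈C , λ _ → refl) , refl)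
... | W' , W'∈D , top≡ψW' = top-reverse k 1≤k k<n ψ q (begin
  top k (ψ · q · ρ₀)        ≡⟨ top≡ψW' ⟩
  imageSub ψ W'             ≡⟨ cong (imageSub ψ) (Equivalence.to (only-W W') W'∈D) ⟩
  imageSub ψ W              ≡⟨ cong (imageSub ψ) (Equivalence.to (only-W (top k q)) (q , q∈C , refl)) ⟨
  imageSub ψ (top k q)      ∎)
  where open ≡-Reasoning

induced-consistent : ∀ {h n} k → 1 ≤ k → k < n → {U : G h n → Set} {C : SPC h n} →
  DecisiveSPC C → Symmetric U C → Consistent U (induced k C)
induced-consistent k 1≤k k<n dec sym-C p ⟨ φ , ψ , ρ ⟩ Ug =
  (λ { refl → induced-equivariant k sym-C p φ ψ Ug }) ,
  (λ { refl → induced-reversal k 1≤k k<n dec sym-C p φ ψ Ug })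

resolute⇒decisive : ∀ {h n} {C : SPC h n} → ResoluteSPC C → DecisiveSPC C
resolute⇒decisive res p = proj₁ (res p) , proj₁ (proj₂ (res p))

proposition13 : (n h : ℕ) → 2 ≤ n → 2 ≤ h →
    (U : G h n → Set) → IsSubgroup U →
    (k : ℕ) → 1 ≤ k → k < n →
    (C : SPC h n) → WellDefinedSPC C → DecisiveSPC C →
    (∃ λ C' → WellDefinedSPC C' × ResoluteSPC C' × RefinesSPC C' C × Symmetric U C') →
    ∃ λ D → WellDefinedMW D × IsKMultiwinner k D × ResoluteMW D ×
      RefinesMW D (induced k C) × Consistent U D
proposition13 n h _ _ U _ k 1≤k k<n C _ _ (C' , wd , res , ref , sym-C') =
  induced k C' ,
  induced-wellDefined k {C'} wd ,
  induced-kMultiwinner k (≤-trans (n≤1+n k) k<n) C' ,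
  induced-resolute k res ,
  induced-refines k ref ,
  induced-consistent k 1≤k k<n (resolute⇒decisive res) sym-C'
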